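{- Let $\wp\in\mathrm{Qnt}(V)$ be a quantification prefix over a set of variables $V$ and $D$ a set. Let $\theta\in\mathrm{DM}_D(\wp)$ and $\overline\theta\in\mathrm{DM}_D(\overline\wp)$ be two dependence maps. Then there exists a valuation $v\in\mathrm{Val}_D(V)$ such that $v=\theta(v|_{\mathcal{U}(\wp)})=\overline\theta(v|_{\mathcal{U}(\overline\wp)})$.
   Context: A quantification prefix over a finite set $V$ of variables is a word over $\{\langle\langle x\rangle\rangle,[[x]]:x\in V\}$ (existential/universal quantifiers) in which each $x\in V$ occurs exactly once; $\mathrm{Qnt}(V)$ is their set. $\mathcal{E}(\wp)$, $\mathcal{U}(\wp)$ are its existentially/universally quantified variables; for $y\in\mathcal{E}(\wp)$, $\mathrm{Dep}(\wp,y)$ is the set of $x\in\mathcal{U}(\wp)$ occurring before $y$ in $\wp$. The dual $\overline\wp$ is obtained by replacing each $\langle\langle x\rangle\rangle$ by $[[x]]$ and vice versa (so $\mathcal{E}(\overline\wp)=\mathcal{U}(\wp)$, $\mathcal{U}(\overline\wp)=\mathcal{E}(\wp)$). $\mathrm{Val}_D(W)$ is the set of functions $W\to D$. A dependence map for $\wp$ over $D$ is $\theta:\mathrm{Val}_D(\mathcal{U}(\wp))\to\mathrm{Val}_D(V)$ such that (1) $\theta(v)|_{\mathcal{U}(\wp)}=v$, and (2) for every $x\in\mathcal{E}(\wp)$, $\theta(v_1)(x)=\theta(v_2)(x)$ whenever $v_1,v_2$ agree on $\mathrm{Dep}(\wp,x)$. $\mathrm{DM}_D(\wp)$ is the set of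 dependence maps. -}

module Defs where

open import Data.Nat using (ℕ)
open import Data.Fin using (Fin)
open import Data.List using (List; _∷_; []; _++_; map)
open import Data.List.Membership.Propositional using (_∈_)
open import Data.List.Relation.Unary.Unique.Propositional using (Unique)
open import Data.Product using (Σ; Σ-syntax; ∃-syntax; _×_; _,_; proj₁; proj₂)
open import Relation.Binary.PropositionalEquality using (_≡_)

-- Variables: V = Fin n (a finite set of variables).
-- Quantifiers: ⟨⟨x⟩⟩ (existential) and [[x]] (universal).
data Quant : Set where
  ex : Quant
  un : Quant

flipQ : Quant → Quant
flipQ ex = un
flipQ un = ex

Prefix : ℕ → Set
Prefix n = List (Quant × Fin n)

Qnt : ∀ {n} → Prefix n → Set
Qnt {n} ℘ = Unique (map proj₂ ℘) × (∀ (x : Fin n) → x ∈ map proj₂ ℘)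

𝓔 : ∀ {n} → Prefix n → Fin n → Set
𝓔 ℘ x = (ex , x) ∈ ℘

𝓤 : ∀ {n} → Prefix n → Fin n → Set
𝓤 ℘ x = (un , x) ∈ ℘

Dep : ∀ {n} → Prefix n → Fin n → Fin n → Set
Dep ℘ y x = Σ[ ℓ₁ ∈ List _ ] Σ[ ℓ₂ ∈ List _ ]
              (℘ ≡ ℓ₁ ++ ((ex , y) ∷ ℓ₂)) × ((un , x) ∈ ℓ₁)

dual : ∀ {n} → Prefix n → Prefix n
dual = map (λ { (q , x) → (flipQ q , x) })

Val : ∀ {n} → Set → (Fin n → Set) → Set
Val {n} D W = Σ (Fin n) W → D

FullVal : ℕ → Set → Set
FullVal n D = Fin n → D

restrict : ∀ {n} {D : Set} (W : Fin n → Set) → FullVal n D → Val D W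
restrict W v (x , _) = v x

IsDM : ∀ {n} (℘ : Prefix n) (D : Set) → (Val D (𝓤 ℘) → FullVal n D) → Set
IsDM {n} ℘ D θ =
    (∀ (v : Val D (𝓤 ℘)) (x : Fin n) (p : 𝓤 ℘ x) → θ v x ≡ v (x , p))
  × (∀ (x : Fin n) → 𝓔 ℘ x → ∀ (v₁ v₂ : Val D (𝓤 ℘)) →
       (∀ (z : Fin n) (p : 𝓤 ℘ z) → Dep ℘ x z → v₁ (z , p) ≡ v₂ (z , p)) →
       θ v₁ x ≡ θ v₂ x)

DM : ∀ {n} (℘ : Prefix n) (D : Set) → Set
DM {n} ℘ D = Σ (Val D (𝓤 ℘) → FullVal n D) (IsDM ℘ D)

module Submission where

-- Merge the two dependence maps into one update map F on full
-- valuations: a variable existential in ℘ is recomputed by θ, a variable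
-- universal in ℘ (existential in the dual) by θ̄.  A valuation v satisfies
-- both equations of the theorem exactly when v is a fixed point of F, since
-- each dependence map copies back the variables it treats as universal.
--
-- Write K = x₁ … x_N for the variables in prefix order.  A dependence map
-- computes an existential variable only from variables strictly earlier in
-- the prefix, so F is "prefix-contractive": valuations agreeing on the first
-- j variables have images agreeing on the first j + 1.  Iterating any such
-- map N times from an arbitrary valuation yields a fixed point on K.

open import Defs
open import Data.Nat using (ℕ; zero; suc)
open import Data.Nat.Properties using (≤-refl)
open import Data.Fin using (Fin)
open import Data.Product using (Σ-syntax; _×_; _,_; proj₁; proj₂)
open import Data.List using (List; _∷_; []; _++_; map; take; length)
open import Data.List.Properties using (take-all; map-++; map-∘)
open import Data.List.Membership.Propositional using (_∈_)
open import Data.List.Membership.Propositional.Properties using (∈-map⁺; ∈-map⁻; ∈-++⁺ʳ)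
open import Data.List.Relation.Unary.Any using (here; there)
open import Data.List.Relation.Unary.All as All using ()
open import Data.List.Relation.Unary.AllPairs using (_∷_)
open import Data.List.Relation.Unary.Unique.Propositional using (Unique)
open import Data.Empty using (⊥-elim)
open import Relation.Binary.PropositionalEquality using (_≡_; refl; sym; subst)

AgreeOn : {A D : Set} → List A → (A → D) → (A → D) → Set
AgreeOn xs w w′ = ∀ {x} → x ∈ xs → w x ≡ w′ x

earlier-in-take : {A : Set} (ys zs : List A) {x z : A} (j : ℕ) →
                  Unique (ys ++ x ∷ zs) → x ∈ take (suc j) (ys ++ x ∷ zs) →
                  z ∈ ys → z ∈ take j (ys ++ x ∷ zs)
earlier-in-take (y ∷ ys) zs j (y∉rest ∷ _) (here x≡y) _ =
  ⊥-elim (All.lookup y∉rest (∈-++⁺ʳ ys (here refl)) (sym x≡y))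
earlier-in-take (y ∷ ys) zs (suc j) _ (there _) (here z≡y) = here z≡y
earlier-in-take (y ∷ ys) zs (suc j) (_ ∷ uniq) (there x∈) (there z∈) =
  there (earlier-in-take ys zs j uniq x∈ z∈)

module PrefixContraction {A D : Set} (K : List A) (F : (A → D) → (A → D))
  (contractive : ∀ j {w w′} → AgreeOn (take j K) w w′ →
                 AgreeOn (take (suc j) K) (F w) (F w′)) where

  iterate : (A → D) → ℕ → (A → D)
  iterate w zero    = w
  iterate w (suc j) = F (iterate w j)

  settles : ∀ w j → AgreeOn (take j K) (iterate w j) (iterate w (suc j))
  settles w zero    ()
  settles w (suc j) = contractive j (settles w j)

  fixed-point : (A → D) → Σ[ v ∈ (A → D) ] AgreeOn K v (F v)
  fixed-point w = iterate w (length K) , λ {x} x∈K →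
    settles w (length K) (subst (x ∈_) (sym (take-all (length K) K ≤-refl)) x∈K)

vars : ∀ {n} → Prefix n → List (Fin n)
vars = map proj₂

vars-dual : ∀ {n} (℘ : Prefix n) → vars (dual ℘) ≡ vars ℘
vars-dual ℘ = sym (map-∘ ℘)

dep-earlier : ∀ {n} (℘ : Prefix n) {x z : Fin n} (j : ℕ) → Unique (vars ℘) →
              x ∈ take (suc j) (vars ℘) → Dep ℘ x z → z ∈ take j (vars ℘)
dep-earlier _ {x} j uniq x∈ (ℓ₁ , ℓ₂ , refl , z∈ℓ₁) =
  subst (λ L → _ ∈ take j L) (sym split)
    (earlier-in-take (vars ℓ₁) (vars ℓ₂) j
      (subst Unique split uniq) (subst (λ L → x ∈ take (suc j) L) split x∈)
      (∈-map⁺ proj₂ z∈ℓ₁))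
  where split = map-++ proj₂ ℓ₁ ((ex , x) ∷ ℓ₂)

DM-contractive : ∀ {n} {D : Set} (℘ : Prefix n) → Unique (vars ℘) → (θ : DM ℘ D) →
                 ∀ {x} → 𝓔 ℘ x → ∀ j {w w′ : FullVal n D} →
                 x ∈ take (suc j) (vars ℘) → AgreeOn (take j (vars ℘)) w w′ →
                 proj₁ θ (restrict (𝓤 ℘) w) x ≡ proj₁ θ (restrict (𝓤 ℘) w′) x
DM-contractive ℘ uniq θ {x} x∈𝓔 j x∈ agree =
  proj₂ (proj₂ θ) x x∈𝓔 _ _ λ z _ dep → agree (dep-earlier ℘ j uniq x∈ dep)

module Solution {n : ℕ} (℘ : Prefix n) (qnt : Qnt ℘) {D : Set}
                (θ : DM ℘ D) (θ̄ : DM (dual ℘) D) where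

  uniq : Unique (vars ℘)
  uniq = proj₁ qnt

  uniq-dual : Unique (vars (dual ℘))
  uniq-dual = subst Unique (sym (vars-dual ℘)) uniq

  Quantified : Fin n → Set
  Quantified x = Σ[ q ∈ Quant ] (q , x) ∈ ℘

  quantifier : ∀ x → Quantified x
  quantifier x with ∈-map⁻ proj₂ (proj₂ qnt x)
  ... | (q , _) , q∈℘ , refl = q , q∈℘

  dual-ex : ∀ {x} → (un , x) ∈ ℘ → 𝓔 (dual ℘) x
  dual-ex = ∈-map⁺ _

  dual-un : ∀ {x} → (ex , x) ∈ ℘ → 𝓤 (dual ℘) x
  dual-un = ∈-map⁺ _

  update : FullVal n D → ∀ x → Quantified x → D
  update w x (ex , _) = proj₁ θ (restrict (𝓤 ℘) w) x
  update w x (un , _) = proj₁ θ̄ (restrict (𝓤 (dual ℘)) w) x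

  F : FullVal n D → FullVal n D
  F w x = update w x (quantifier x)

  F-contractive : ∀ j {w w′} → AgreeOn (take j (vars ℘)) w w′ →
                  AgreeOn (take (suc j) (vars ℘)) (F w) (F w′)
  F-contractive j {w} {w′} agree {x} x∈ with quantifier x
  ... | ex , x∈𝓔 = DM-contractive ℘ uniq θ x∈𝓔 j x∈ agree
  ... | un , x∈𝓤 = DM-contractive (dual ℘) uniq-dual θ̄ (dual-ex x∈𝓤) j
      (subst (λ L → x ∈ take (suc j) L) (sym (vars-dual ℘)) x∈)
      (subst (λ L → AgreeOn (take j L) w w′) (sym (vars-dual ℘)) agree)

  -- A fixed point of F satisfies both equations: on its own existential
  -- variables each map agrees with F, on the others it copies the input.
  fixed-θ : ∀ {v} x (qx : Quantified x) → v x ≡ update v x qx →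
            v x ≡ proj₁ θ (restrict (𝓤 ℘) v) x
  fixed-θ     x (ex , _)   v≡ = v≡
  fixed-θ {v} x (un , x∈𝓤) _  = sym (proj₁ (proj₂ θ) (restrict (𝓤 ℘) v) x x∈𝓤)

  fixed-θ̄ : ∀ {v} x (qx : Quantified x) → v x ≡ update v x qx →
            v x ≡ proj₁ θ̄ (restrict (𝓤 (dual ℘)) v) x
  fixed-θ̄ {v} x (ex , x∈𝓔) _  = sym (proj₁ (proj₂ θ̄) (restrict (𝓤 (dual ℘)) v) x (dual-un x∈𝓔))
  fixed-θ̄     x (un , _)   v≡ = v≡

lemmaB1 : ∀ {n : ℕ} (℘ : Prefix n) → Qnt ℘ → (D : Set) → D →
          (θ : DM ℘ D) (θ̄ : DM (dual ℘) D) →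
          Σ[ v ∈ FullVal n D ]
            ((∀ (x : Fin n) → v x ≡ proj₁ θ (restrict (𝓤 ℘) v) x)
           × (∀ (x : Fin n) → v x ≡ proj₁ θ̄ (restrict (𝓤 (dual ℘)) v) x))
lemmaB1 ℘ qnt D d θ θ̄ =
  v , (λ x → fixed-θ x (quantifier x) (v≡Fv x)) , (λ x → fixed-θ̄ x (quantifier x) (v≡Fv x))
  where
  open Solution ℘ qnt θ θ̄
  open PrefixContraction (vars ℘) F F-contractive
  v : FullVal _ D
  v = proj₁ (fixed-point (λ _ → d))
  v≡Fv : ∀ x → v x ≡ F v x
  v≡Fv x = proj₂ (fixed-point (λ _ → d)) (proj₂ qnt x)
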